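{- For every finite poset $P$, as $k\to\infty$, $La([k]^2,P)\le\left(\frac{|P|+h(P)}{2}-1\right)k+O(1)$. In particular, $La([k]^2,D_2)=\frac52 k+O(1)$ and $La([k]^2,D_3)=3k+O(1)$.
   Context: $[k]^2$ carries the coordinatewise order. A poset $P$ is a weak subposet of $R$ if there is an injection $i:P\to R$ with $p\le_P p'\Rightarrow i(p)\le_R i(p')$; a subset $F$ of a poset $Q$ is weak $P$-free if $P$ is not a weak subposet of $F$, and $La(Q,P)$ is the maximum size of a weak $P$-free subset of $Q$. $h(P)$ is the height of $P$, the maximum number of elements of a chain in $P$. For $m\ge1$, the diamond $D_m$ is the poset on $m+2$ elements $a,b_1,\dots,b_m,c$ with $a<b_i<c$ for all $i$ (and $a<c$), and no other relations. -}

module Defs where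

open import Level using (0ℓ)
open import Data.Nat using (ℕ; zero; suc; _+_; _*_; _≤_)
open import Data.Fin using (Fin; toℕ)
open import Data.Product using (_×_; Σ; ∃; _,_)
open import Data.Sum using (_⊎_)
open import Data.List using (List; length)
open import Data.List.Membership.Propositional using (_∈_)
open import Data.List.Relation.Unary.Unique.Propositional using (Unique)
open import Data.List.Relation.Unary.AllPairs using (AllPairs)
open import Relation.Binary using (Rel; IsPartialOrder)
open import Relation.Binary.PropositionalEquality using (_≡_)
open import Relation.Nullary using (¬_)
open import Function.Definitions using (Injective)

record FinPoset : Set₁ where
  field
    size  : ℕ
    _≤P_  : Rel (Fin size) 0ℓ
    isPO  : IsPartialOrder _≡_ _≤P_

∣_∣P : FinPoset → ℕ
∣ P ∣P = FinPoset.size P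

IsChain : (P : FinPoset) → List (Fin (FinPoset.size P)) → Set
IsChain P xs = Unique xs × AllPairs (λ x y → (x ≤P y) ⊎ (y ≤P x)) xs
  where open FinPoset P

IsHeight : FinPoset → ℕ → Set
IsHeight P h =
  (Σ (List (Fin (FinPoset.size P))) λ xs → IsChain P xs × length xs ≡ h)
  × (∀ xs → IsChain P xs → length xs ≤ h)

Grid : ℕ → Set
Grid k = Fin k × Fin k

_≤G_ : ∀ {k} → Grid k → Grid k → Set
(a , b) ≤G (c , d) = (toℕ a ≤ toℕ c) × (toℕ b ≤ toℕ d)

Subset² : ℕ → Set
Subset² k = Σ (List (Grid k)) Unique

∣_∣S : ∀ {k} → Subset² k → ℕ
∣ (xs , _) ∣S = length xs

WeakSub : ∀ {n k} → Rel (Fin n) 0ℓ → Subset² k → Set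
WeakSub {n} {k} R (xs , _) =
  Σ (Fin n → Grid k) λ i →
    Injective _≡_ _≡_ i × (∀ p → i p ∈ xs) × (∀ p p' → R p p' → i p ≤G i p')

WeakFree : ∀ {n k} → Rel (Fin n) 0ℓ → Subset² k → Set
WeakFree R F = ¬ WeakSub R F

-- Diamond D_m on Fin (m + 2): a = element 0, c = element m+1, b_i the rest;
-- order: x ≤ y iff x = y, or x = a, or y = c.
Diamond : (m : ℕ) → Rel (Fin (suc (suc m))) 0ℓ
Diamond m x y = (x ≡ y) ⊎ (toℕ x ≡ 0) ⊎ (toℕ y ≡ suc m)

-- Rank the elements of P by the length of the longest chain below them (Mirsky), so ranks are
-- below h and strictly increase along the order. Cut [k]² into ⌈k/2⌉ bands of four consecutive
-- diagonals and sort each band by a key. In a band a point fails to lie above an earlier one only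
-- if it sits on an outer diagonal at most two key steps later, and two outer points are at least
-- two key steps apart; so, embedding P greedily rank by rank, at most one point is wasted per rank,
-- and a band with |P| + h − 1 points contains P. Hence a P-free family meets each band in at most
-- |P| + h − 2 points. For the diamonds (height 3) the lower bounds are three consecutive
-- antidiagonals, for D₂ with only the odd columns kept on the middle one: the middle elements
-- of a diamond must lie on the middle antidiagonal, in one of the two positions just above its
-- bottom element, which leaves room for only two of them, and with odd columns for only one.

module Submission where

open import Defs
open import Level using (0ℓ)
open import Function using (_∘_; id)
open import Data.Empty using (⊥; ⊥-elim)
open import Data.Product using (_×_; Σ; ∃; _,_; proj₁; proj₂)
open import Data.Sum using (_⊎_; inj₁; inj₂; [_,_]′)
open import Data.Nat using (ℕ; zero; suc; pred; _+_; _*_; _∸_; _⊔_; _≤_; _<_; _≟_; _≤?_; _<?_; z≤n; s≤s; ≢-nonZero; ⌊_/2⌋; ⌈_/2⌉)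
open import Data.Nat.Properties
open import Data.Nat.DivMod using (_/_; _%_; _mod_; m≡m%n+[m/n]*n; m%n<n)
open import Data.Nat.Tactic.RingSolver using (solve-∀)
open import Data.Fin as Fin using (Fin; zero; suc; toℕ; fromℕ<)
open import Data.Fin.Properties using (toℕ<n; toℕ-injective; toℕ-fromℕ<; toℕ-fromℕ; all?)
open import Data.List using (List; []; _∷_; _++_; length; take; drop; filter; tabulate; allFin)
open import Data.List.Properties using (length-take; length-++; length-filter; length-tabulate; take++drop≡id)
open import Data.List.Membership.Propositional using (_∈_)
open import Data.List.Membership.Propositional.Properties
  using (∈-++⁺ˡ; ∈-++⁺ʳ; ∈-++⁻; ∈-filter⁺; ∈-filter⁻; ∈-tabulate⁻; ∈-allFin)
open import Data.List.Relation.Unary.Any using (Any; here; there)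
open import Data.List.Relation.Unary.All as All using (All; []; _∷_)
open import Data.List.Relation.Unary.All.Properties using (¬All⇒Any¬)
open import Data.List.Relation.Unary.AllPairs as AllPairs using (AllPairs; []; _∷_)
import Data.List.Relation.Unary.AllPairs.Properties as AllPairs
open import Data.List.Relation.Unary.Unique.Propositional using (Unique)
import Data.List.Relation.Unary.Unique.Propositional.Properties as Unique
open import Data.List.Relation.Unary.Sorted.TotalOrder.Properties using (Sorted⇒AllPairs)
open import Data.List.Relation.Binary.Disjoint.Propositional using (Disjoint)
open import Data.List.Relation.Binary.Permutation.Propositional using (↭-sym; ↭⇒↭ₛ)
open import Data.List.Relation.Binary.Permutation.Propositional.Properties using (All-resp-↭; ∈-resp-↭; ↭-length)
open import Data.List.Relation.Binary.Sublist.Propositional.Properties as Sublist using (filter-⊆; length-mono-≤)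
open import Relation.Nullary using (¬_; Dec; yes; no; ¬?)
open import Relation.Nullary.Decidable using (_×-dec_; _⊎-dec_; _→-dec_; from-yes; decidable-stable; ¬¬-excluded-middle)
open import Relation.Unary using (Pred)
open import Relation.Binary using (Rel; Decidable; DecidableEquality; DecTotalOrder; IsPartialOrder)
import Relation.Binary.Construct.On as On
open import Relation.Binary.PropositionalEquality

2*⌊n/2⌋≤n : ∀ n → 2 * ⌊ n /2⌋ ≤ n
2*⌊n/2⌋≤n 0 = z≤n
2*⌊n/2⌋≤n 1 = z≤n
2*⌊n/2⌋≤n (suc (suc n)) rewrite *-suc 2 ⌊ n /2⌋ = s≤s (s≤s (2*⌊n/2⌋≤n n))

n≤1+2*⌊n/2⌋ : ∀ n → n ≤ suc (2 * ⌊ n /2⌋)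
n≤1+2*⌊n/2⌋ 0 = z≤n
n≤1+2*⌊n/2⌋ 1 = s≤s z≤n
n≤1+2*⌊n/2⌋ (suc (suc n)) rewrite *-suc 2 ⌊ n /2⌋ = s≤s (s≤s (n≤1+2*⌊n/2⌋ n))

length-filter-split : ∀ {A : Set} {P : Pred A 0ℓ} (P? : Relation.Unary.Decidable P) xs →
  length xs ≡ length (filter P? xs) + length (filter (¬? ∘ P?) xs)
length-filter-split P? [] = refl
length-filter-split P? (x ∷ xs) with P? x
... | yes _ = cong suc (length-filter-split P? xs)
... | no _  = trans (cong suc (length-filter-split P? xs)) (sym (+-suc _ _))

∈-take⁻ : ∀ {A : Set} n {xs : List A} {x} → x ∈ take n xs → x ∈ xs
∈-take⁻ n {xs} x∈ = subst (_ ∈_) (take++drop≡id n xs) (∈-++⁺ˡ x∈)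

∈-drop⁻ : ∀ {A : Set} n {xs : List A} {x} → x ∈ drop n xs → x ∈ xs
∈-drop⁻ n {xs} x∈ = subst (_ ∈_) (take++drop≡id n xs) (∈-++⁺ʳ (take n xs) x∈)

module _ {A : Set} {R : Rel A 0ℓ} where

  AllPairs-take-drop : ∀ n {xs x y} → AllPairs R xs → x ∈ take n xs → y ∈ drop n xs → R x y
  AllPairs-take-drop (suc n) {_ ∷ xs} (Rx ∷ _)  (here refl) y∈ = All.lookup Rx (∈-drop⁻ n y∈)
  AllPairs-take-drop (suc n) {_ ∷ xs} (_ ∷ Rxs) (there x∈) y∈ = AllPairs-take-drop n Rxs x∈ y∈

AllPairs-within : ∀ {A : Set} {P : A → Set} {R S : Rel A 0ℓ} →
  (∀ {x y} → P x → P y → R x y → S x y) → ∀ {xs} → All P xs → AllPairs R xs → AllPairs S xs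
AllPairs-within f [] [] = []
AllPairs-within f (px ∷ pxs) (rx ∷ rxs) =
  All.zipWith (λ (py , r) → f px py r) (pxs , rx) ∷ AllPairs-within f pxs rxs

length-by-classes : ∀ {A : Set} (c : A → ℕ) {M} B xs → All (λ x → c x < B) xs →
  (∀ b → length (filter (λ x → c x ≟ b) xs) + 2 ≤ M) → length xs + 2 * B ≤ B * M
length-by-classes c zero [] _ _ = z≤n
length-by-classes c zero (_ ∷ _) (cx<0 ∷ _) _ = ⊥-elim (n≮0 cx<0)
length-by-classes c {M} (suc B) xs c<B classes = begin
  length xs + 2 * suc B                        ≡⟨ cong (_+ 2 * suc B) (length-filter-split top? xs) ⟩
  length top + length rest + 2 * suc B         ≡⟨ rearrange (length top) (length rest) B ⟩
  (length top + 2) + (length rest + 2 * B)     ≤⟨ +-mono-≤ (classes B) (length-by-classes c B rest rest<B rest-classes) ⟩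
  M + B * M                                    ∎
  where
  open ≤-Reasoning
  top? = λ x → c x ≟ B
  top = filter top? xs
  rest = filter (¬? ∘ top?) xs
  rearrange : ∀ t r B → t + r + 2 * suc B ≡ (t + 2) + (r + 2 * B)
  rearrange = solve-∀
  rest<B : All (λ x → c x < B) rest
  rest<B = All.tabulate λ x∈ → let x∈xs , cx≢B = ∈-filter⁻ (¬? ∘ top?) {xs = xs} x∈ in
    ≤∧≢⇒< (≤-pred (All.lookup c<B x∈xs)) cx≢B
  rest-classes : ∀ b → length (filter (λ x → c x ≟ b) rest) + 2 ≤ M
  rest-classes b = ≤-trans (+-monoˡ-≤ 2 (length-mono-≤ sub)) (classes b)
    where
    sub = Sublist.filter⁺ (λ x → c x ≟ b) (λ x → c x ≟ b) (λ { refl cx≡b → cx≡b }) (filter-⊆ (¬? ∘ top?) xs)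

-- Mirsky ranks

⨆ : ∀ {n} → (Fin n → ℕ) → ℕ
⨆ {zero}  f = 0
⨆ {suc n} f = f Fin.zero ⊔ ⨆ (f ∘ Fin.suc)

≤-⨆ : ∀ {n} (f : Fin n → ℕ) i → f i ≤ ⨆ f
≤-⨆ f Fin.zero    = m≤m⊔n _ _
≤-⨆ f (Fin.suc i) = ≤-trans (≤-⨆ (f ∘ Fin.suc) i) (m≤n⊔m _ _)

⨆-least : ∀ {n} (f : Fin n → ℕ) {c} → (∀ i → f i ≤ c) → ⨆ f ≤ c
⨆-least {zero}  f f≤c = z≤n
⨆-least {suc n} f f≤c = ⊔-lub (f≤c Fin.zero) (⨆-least (f ∘ Fin.suc) (f≤c ∘ Fin.suc))

⨆-cong : ∀ {n} {f g : Fin n → ℕ} → (∀ i → f i ≡ g i) → ⨆ f ≡ ⨆ g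
⨆-cong {zero}  f≗g = refl
⨆-cong {suc n} f≗g = cong₂ _⊔_ (f≗g Fin.zero) (⨆-cong (f≗g ∘ Fin.suc))

⨆-attained : ∀ {n} (f : Fin n → ℕ) → ⨆ f ≡ 0 ⊎ ∃ λ i → ⨆ f ≡ f i
⨆-attained {zero}  f = inj₁ refl
⨆-attained {suc n} f with ⊔-sel (f Fin.zero) (⨆ (f ∘ Fin.suc)) | ⨆-attained (f ∘ Fin.suc)
... | inj₁ e | _              = inj₂ (Fin.zero , e)
... | inj₂ e | inj₁ e′        = inj₁ (trans e e′)
... | inj₂ e | inj₂ (i , e′)  = inj₂ (Fin.suc i , trans e e′)

RankFunction : ∀ {n} → Rel (Fin n) 0ℓ → ℕ → Set
RankFunction {n} R h =
  Σ (Fin n → ℕ) λ ℓ → (∀ p → ℓ p < h) × (∀ p q → R p q → p ≡ q ⊎ ℓ p < ℓ q)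

module Mirsky (P : FinPoset) (_≤?_ : Decidable (FinPoset._≤P_ P)) where
  open FinPoset P
  private module PO = IsPartialOrder isPO

  _<P_ : Rel (Fin size) 0ℓ
  p <P q = p ≤P q × p ≢ q

  _<P?_ : Decidable _<P_
  p <P? q = (p ≤? q) ×-dec ¬? (p Fin.≟ q)

  <P-trans : ∀ {p q r} → p <P q → q <P r → p <P r
  <P-trans (p≤q , p≢q) (q≤r , q≢r) =
    PO.trans p≤q q≤r , λ { refl → p≢q (PO.antisym p≤q q≤r) }

  sucIf : ∀ {A : Set} → Dec A → ℕ → ℕ
  sucIf (yes _) d = suc d
  sucIf (no _)  _ = 0

  -- depth t p is the length of a longest chain strictly below p, truncated at t.
  depth : ℕ → Fin size → ℕ
  depth zero    p = 0
  depth (suc t) p = ⨆ λ q → sucIf (q <P? p) (depth t q)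

  depth≤ : ∀ t p → depth t p ≤ t
  depth≤ zero    p = z≤n
  depth≤ (suc t) p = ⨆-least _ bound
    where
    bound : ∀ q → sucIf (q <P? p) (depth t q) ≤ suc t
    bound q with q <P? p
    ... | yes _ = s≤s (depth≤ t q)
    ... | no _  = z≤n

  depth-<-suc : ∀ t {p q} → p <P q → depth t p < depth (suc t) q
  depth-<-suc t {p} {q} p<q with p <P? q | ≤-⨆ (λ r → sucIf (r <P? q) (depth t r)) p
  ... | yes _   | below = below
  ... | no p≮q  | _     = ⊥-elim (p≮q p<q)

  depth-stable : ∀ t p → depth t p < t → depth (suc t) p ≡ depth t p
  depth-stable (suc t) p d<t = ⨆-cong same
    where
    same : ∀ q → sucIf (q <P? p) (depth (suc t) q) ≡ sucIf (q <P? p) (depth t q)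
    same q with q <P? p | ≤-⨆ (λ r → sucIf (r <P? p) (depth t r)) q
    ... | yes _ | below = cong suc (depth-stable t q (≤-pred (≤-trans (s≤s below) d<t)))
    ... | no _  | _     = refl

  Descending : List (Fin size) → Set
  Descending = AllPairs (λ p q → q <P p)

  descending-chain : ∀ t p → ∃ λ cs → Descending (p ∷ cs) × length cs ≡ depth t p
  descending-chain zero    p = [] , [] ∷ [] , refl
  descending-chain (suc t) p with ⨆-attained (λ q → sucIf (q <P? p) (depth t q))
  ... | inj₁ d≡0 = [] , [] ∷ [] , sym d≡0
  ... | inj₂ (q , d≡) with q <P? p | descending-chain t q
  ...   | no _  | _ = [] , [] ∷ [] , sym d≡
  ...   | yes q<p | cs , below-q ∷ desc , len =
          q ∷ cs , (q<p ∷ All.map (λ c<q → <P-trans c<q q<p) below-q) ∷ below-q ∷ desc ,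
          trans (cong suc len) (sym d≡)

  descending⇒chain : ∀ {xs} → Descending xs → IsChain P xs
  descending⇒chain desc =
    AllPairs.map (λ q<p p≡q → proj₂ q<p (sym p≡q)) desc , AllPairs.map (inj₂ ∘ proj₁) desc

  ranking : ∀ h → (∀ xs → IsChain P xs → length xs ≤ h) → RankFunction _≤P_ h
  ranking h chain≤h = depth h , depth<h , monotone
    where
    depth<h : ∀ p → depth h p < h
    depth<h p with descending-chain h p
    ... | cs , desc , len = subst (_≤ h) (cong suc len) (chain≤h (p ∷ cs) (descending⇒chain desc))

    monotone : ∀ p q → p ≤P q → p ≡ q ⊎ depth h p < depth h q
    monotone p q p≤q with p Fin.≟ q
    ... | yes p≡q = inj₁ p≡q
    ... | no p≢q  = inj₂ (subst (depth h p <_) (depth-stable h q (depth<h q)) (depth-<-suc h (p≤q , p≢q)))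

-- Greedy embedding into a nearly sorted list

module NearChain {A : Set} (_≼_ : Rel A 0ℓ) (_≼?_ : Decidable _≼_) (key : A → ℕ) (Outer : A → Set) where

  Near : Rel A 0ℓ
  Near u v = key u < key v × (u ≼ v ⊎ Outer v × key v ≤ key u + 2) × (Outer u → Outer v → key u + 2 ≤ key v)

  Above : List A → A → Set
  Above us v = All (_≼ v) us

  above? : ∀ us → Relation.Unary.Decidable (Above us)
  above? us v = All.all? (_≼? v) us

  private
    Bad : List A → A → Set
    Bad us v = All (λ u → Near u v) us × Any (λ u → ¬ u ≼ v) us

    bad-outer : ∀ {us v} → Bad us v → ∃ λ u → u ∈ us × Outer v × key v ≤ key u + 2
    bad-outer {u ∷ _} (near ∷ _ , here u⋠v) with proj₁ (proj₂ near)
    ... | inj₁ u≼v = ⊥-elim (u⋠v u≼v)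
    ... | inj₂ (outer , close) = u , here refl , outer , close
    bad-outer (_ ∷ near , there u⋠v) with bad-outer (near , u⋠v)
    ... | u , u∈ , outer , close = u , there u∈ , outer , close

    -- Two bad elements v before v′ would both be outer, yet v′ is at most one key step above v.
    bad-pair : ∀ {us v v′} → Bad us v → Bad us v′ → Near v v′ → ⊥
    bad-pair bv@(near , _) bv′ (_ , _ , separated) with bad-outer bv | bad-outer bv′
    ... | _ , _ , outer , _ | u′ , u′∈ , outer′ , close′ =
      <-irrefl refl (≤-trans (s≤s (≤-trans (separated outer outer′) close′))
                             (+-monoˡ-< 2 (proj₁ (All.lookup near u′∈))))

    bad≤1 : ∀ {us vs} → All (Bad us) vs → AllPairs Near vs → length vs ≤ 1
    bad≤1 [] _ = z≤n
    bad≤1 (_ ∷ []) _ = s≤s z≤n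
    bad≤1 (bv ∷ bv′ ∷ _) ((near ∷ _) ∷ _) = ⊥-elim (bad-pair bv bv′ near)

  not-above≤1 : ∀ n {ts} → AllPairs Near ts →
    length (filter (¬? ∘ above? (take n ts)) (drop n ts)) ≤ 1
  not-above≤1 n {ts} chain = bad≤1 (All.tabulate bad) (AllPairs.filter⁺ _ (AllPairs.drop⁺ n chain))
    where
    bad : ∀ {v} → v ∈ filter (¬? ∘ above? (take n ts)) (drop n ts) → Bad (take n ts) v
    bad v∈ with ∈-filter⁻ (¬? ∘ above? (take n ts)) v∈
    ... | v∈drop , not-above =
      All.tabulate (λ u∈ → AllPairs-take-drop n chain u∈ v∈drop) , ¬All⇒Any¬ (_≼? _) _ not-above

  near⇒≢ : ∀ {u v} → Near u v → u ≢ v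
  near⇒≢ (key< , _) refl = <-irrefl refl key<

  -- a₀ is a junk value: Embeds ℓ ps ts constrains f on ps only.
  module Embedding {E : Set} (_≟E_ : DecidableEquality E) (a₀ : A) where

    Embeds : (E → ℕ) → List E → List A → Set
    Embeds ℓ ps ts = Σ (E → A) λ f →
      (∀ {p} → p ∈ ps → f p ∈ ts) ×
      (∀ {p q} → p ∈ ps → q ∈ ps → f p ≡ f q → p ≡ q) ×
      (∀ {p q} → p ∈ ps → q ∈ ps → ℓ p < ℓ q → f p ≼ f q)

    assign : List E → List A → E → A
    assign []       _        _ = a₀
    assign (_ ∷ _)  []       _ = a₀
    assign (q ∷ qs) (u ∷ us) p with p ≟E q
    ... | yes _ = u
    ... | no _  = assign qs us p

    assign-∈ : ∀ qs us {p} → length qs ≤ length us → p ∈ qs → assign qs us p ∈ us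
    assign-∈ (q ∷ qs) (u ∷ us) {p} (s≤s len) p∈ with p ≟E q | p∈
    ... | yes _  | _          = here refl
    ... | no p≢q | here p≡q   = ⊥-elim (p≢q p≡q)
    ... | no _   | there p∈qs = there (assign-∈ qs us len p∈qs)

    assign-injective : ∀ qs us {p p′} → length qs ≤ length us → AllPairs _≢_ us →
      p ∈ qs → p′ ∈ qs → assign qs us p ≡ assign qs us p′ → p ≡ p′
    assign-injective (q ∷ qs) (u ∷ us) {p} {p′} (s≤s len) (u∉ ∷ distinct) p∈ p′∈ eq
      with p ≟E q | p′ ≟E q | p∈ | p′∈
    ... | yes p≡q | yes p′≡q | _ | _ = trans p≡q (sym p′≡q)
    ... | yes _ | no p′≢q | _ | here p′≡q = ⊥-elim (p′≢q p′≡q)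
    ... | yes _ | no _ | _ | there p′∈qs = ⊥-elim (All.lookup u∉ (assign-∈ qs us len p′∈qs) eq)
    ... | no p≢q | _ | here p≡q | _ = ⊥-elim (p≢q p≡q)
    ... | no _ | yes _ | there p∈qs | _ = ⊥-elim (All.lookup u∉ (assign-∈ qs us len p∈qs) (sym eq))
    ... | no _ | no p′≢q | there _ | here p′≡q = ⊥-elim (p′≢q p′≡q)
    ... | no _ | no _ | there p∈qs | there p′∈qs = assign-injective qs us len distinct p∈qs p′∈qs eq

    module _ (ℓ : E → ℕ) where

      Bottom? : ∀ p → Dec (ℓ p ≡ 0)
      Bottom? p = ℓ p ≟ 0

      Raised? : ∀ p → Dec (ℓ p ≢ 0)
      Raised? = ¬? ∘ Bottom?

      extend : ∀ {ps us vs ts} → (∀ {u} → u ∈ us → u ∈ ts) → (∀ {v} → v ∈ vs → v ∈ ts) →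
        AllPairs _≢_ us → (∀ {u v} → u ∈ us → v ∈ vs → u ≼ v × u ≢ v) →
        length (filter Bottom? ps) ≤ length us → Embeds (pred ∘ ℓ) (filter Raised? ps) vs →
        Embeds ℓ ps ts
      extend {ps} {us} {vs} {ts} us⊆ts vs⊆ts us-distinct us≺vs room (g , g-∈ , g-injective , g-mono) =
        f , f-∈ , f-injective , f-monotone
        where
        f : E → A
        f p with Bottom? p
        ... | yes _ = assign (filter Bottom? ps) us p
        ... | no _  = g p

        bottom-∈ : ∀ {p} → p ∈ ps → ℓ p ≡ 0 → assign (filter Bottom? ps) us p ∈ us
        bottom-∈ p∈ ℓp≡0 = assign-∈ _ us room (∈-filter⁺ Bottom? p∈ ℓp≡0)

        raised : ∀ {p} → p ∈ ps → ℓ p ≢ 0 → p ∈ filter Raised? ps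
        raised = ∈-filter⁺ Raised?

        f-∈ : ∀ {p} → p ∈ ps → f p ∈ ts
        f-∈ {p} p∈ with Bottom? p
        ... | yes ℓp≡0 = us⊆ts (bottom-∈ p∈ ℓp≡0)
        ... | no ℓp≢0  = vs⊆ts (g-∈ (raised p∈ ℓp≢0))

        f-injective : ∀ {p q} → p ∈ ps → q ∈ ps → f p ≡ f q → p ≡ q
        f-injective {p} {q} p∈ q∈ eq with Bottom? p | Bottom? q
        ... | yes ℓp≡0 | yes ℓq≡0 = assign-injective _ us room us-distinct
                                      (∈-filter⁺ Bottom? p∈ ℓp≡0) (∈-filter⁺ Bottom? q∈ ℓq≡0) eq
        ... | yes ℓp≡0 | no ℓq≢0  =
              ⊥-elim (proj₂ (us≺vs (bottom-∈ p∈ ℓp≡0) (g-∈ (raised q∈ ℓq≢0))) eq)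
        ... | no ℓp≢0  | yes ℓq≡0 =
              ⊥-elim (proj₂ (us≺vs (bottom-∈ q∈ ℓq≡0) (g-∈ (raised p∈ ℓp≢0))) (sym eq))
        ... | no ℓp≢0  | no ℓq≢0  = g-injective (raised p∈ ℓp≢0) (raised q∈ ℓq≢0) eq

        f-monotone : ∀ {p q} → p ∈ ps → q ∈ ps → ℓ p < ℓ q → f p ≼ f q
        f-monotone {p} {q} p∈ q∈ ℓp<ℓq with Bottom? p | Bottom? q
        ... | yes ℓp≡0 | yes ℓq≡0 = ⊥-elim (<-irrefl (trans ℓp≡0 (sym ℓq≡0)) ℓp<ℓq)
        ... | yes ℓp≡0 | no ℓq≢0  = proj₁ (us≺vs (bottom-∈ p∈ ℓp≡0) (g-∈ (raised q∈ ℓq≢0)))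
        ... | no _     | yes ℓq≡0 = ⊥-elim (n≮0 (subst (ℓ p <_) ℓq≡0 ℓp<ℓq))
        ... | no ℓp≢0  | no ℓq≢0  =
              g-mono (raised p∈ ℓp≢0) (raised q∈ ℓq≢0) (pred-mono-< {{≢-nonZero ℓp≢0}} ℓp<ℓq)

    budget-step : ∀ {a p d v h} → a + p + suc h ≤ a + d + 1 → d ≤ v + 1 → p + h ≤ v + 1
    budget-step {a} {p} {d} {v} {h} budget d≤v+1 = ≤-pred (+-cancelˡ-≤ a _ _ (begin
      a + suc (p + h)       ≡⟨ shuffle a p h ⟩
      a + p + suc h         ≤⟨ budget ⟩
      a + d + 1             ≤⟨ +-monoˡ-≤ 1 (+-monoʳ-≤ a d≤v+1) ⟩
      a + (v + 1) + 1       ≡⟨ shuffle′ a v ⟩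
      a + suc (v + 1)       ∎))
      where
      open ≤-Reasoning
      shuffle : ∀ a p h → a + suc (p + h) ≡ a + p + suc h
      shuffle = solve-∀
      shuffle′ : ∀ a v → a + (v + 1) + 1 ≡ a + suc (v + 1)
      shuffle′ = solve-∀

    -- Greedily send the minimal elements to the first points, skip the (at most one)
    -- later point that is not above all of them, and recurse on the remaining ranks.
    embed : ∀ h (ℓ : E → ℕ) ps → (∀ {p} → p ∈ ps → ℓ p < h) →
            ∀ ts → AllPairs Near ts → length ps + h ≤ length ts + 1 → Embeds ℓ ps ts
    embed zero ℓ ps ℓ<0 ts _ _ =
      (λ _ → a₀) , (λ p∈ → ⊥-elim (n≮0 (ℓ<0 p∈))) , (λ p∈ _ _ → ⊥-elim (n≮0 (ℓ<0 p∈))) ,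
      (λ p∈ _ _ → ⊥-elim (n≮0 (ℓ<0 p∈)))
    embed (suc h) ℓ ps ℓ<h ts chain budget =
      extend ℓ (∈-take⁻ a) (∈-drop⁻ a ∘ vs⊆rest) (AllPairs.map near⇒≢ (AllPairs.take⁺ a chain))
        us≺vs (≤-reflexive (sym length-us)) upper
      where
      a = length (filter (Bottom? ℓ) ps)
      us = take a ts
      rest = drop a ts
      vs = filter (above? us) rest

      vs⊆rest : ∀ {v} → v ∈ vs → v ∈ rest
      vs⊆rest v∈ = proj₁ (∈-filter⁻ (above? us) {xs = rest} v∈)

      us≺vs : ∀ {u v} → u ∈ us → v ∈ vs → u ≼ v × u ≢ v
      us≺vs u∈ v∈ = All.lookup (proj₂ (∈-filter⁻ (above? us) {xs = rest} v∈)) u∈ ,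
                    near⇒≢ (AllPairs-take-drop a chain u∈ (vs⊆rest v∈))

      length-us : length us ≡ a
      length-us = trans (length-take a ts) (m≤n⇒m⊓n≡m (≤-trans (length-filter (Bottom? ℓ) ps)
                    (+-cancelʳ-≤ 1 _ _ (≤-trans (+-monoʳ-≤ (length ps) (s≤s z≤n)) budget))))

      budget₊ : length (filter (Raised? ℓ) ps) + h ≤ length vs + 1
      budget₊ = budget-step {a}
        (subst₂ (λ p t → p + suc h ≤ t + 1)
          (length-filter-split (Bottom? ℓ) ps)
          (trans (cong length (sym (take++drop≡id a ts))) (trans (length-++ us) (cong (_+ length rest) length-us)))
          budget)
        (≤-trans (≤-reflexive (length-filter-split (above? us) rest)) (+-monoʳ-≤ (length vs) (not-above≤1 a chain)))

      ℓ₊<h : ∀ {p} → p ∈ filter (Raised? ℓ) ps → pred (ℓ p) < h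
      ℓ₊<h p∈ with ∈-filter⁻ (Raised? ℓ) p∈
      ... | p∈ps , ℓp≢0 = pred-mono-< {{≢-nonZero ℓp≢0}} (ℓ<h p∈ps)

      upper : Embeds (pred ∘ ℓ) (filter (Raised? ℓ) ps) vs
      upper = embed h (pred ∘ ℓ) _ ℓ₊<h vs (AllPairs.filter⁺ _ (AllPairs.drop⁺ a chain)) budget₊

-- Bands of four diagonals

-- Inside a band a point is given by X and the offset j of its diagonal, and u ≤ v iff
-- X u ≤ X v and X u + j v ≤ X v + j u. The weights ρ make sorting by 4 X + ρ j respect this,
-- except for points on the outer diagonals j = 0, 3.
Offset : Set
Offset = Fin 4

ρ : Offset → ℕ
ρ zero                   = 6
ρ (suc zero)             = 3
ρ (suc (suc zero))       = 1
ρ (suc (suc (suc zero))) = 0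

weight : ℕ → Offset → ℕ
weight x j = 4 * x + ρ j

Outer : Offset → Set
Outer j = j ≡ Fin.zero ⊎ j ≡ Fin.fromℕ 3

outer? : ∀ j → Dec (Outer j)
outer? j = (j Fin.≟ Fin.zero) ⊎-dec (j Fin.≟ Fin.fromℕ 3)

for-all-below : ∀ {n} {Q : ℕ → Set} → (∀ (t : Fin n) → Q (toℕ t)) → ∀ t → t < n → Q t
for-all-below {Q = Q} holds t t<n = subst Q (toℕ-fromℕ< t<n) (holds (fromℕ< t<n))

weight-jump : ∀ (t : Fin 3) j j′ → toℕ t + toℕ j < toℕ j′ → ρ j < 4 * toℕ t + ρ j′ →
  Outer j′ × 4 * toℕ t + ρ j′ ≤ ρ j + 2
weight-jump = from-yes (all? λ (t : Fin 3) → all? λ (j : Offset) → all? λ (j′ : Offset) →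
  (toℕ t + toℕ j <? toℕ j′) →-dec (ρ j <? 4 * toℕ t + ρ j′) →-dec
  (outer? j′ ×-dec (4 * toℕ t + ρ j′ ≤? ρ j + 2)))

weight-drop : ∀ j j′ → 4 + ρ j < ρ j′ → Outer j′ × ρ j′ ≤ 4 + ρ j + 2
weight-drop = from-yes (all? λ (j : Offset) → all? λ (j′ : Offset) →
  (4 + ρ j <? ρ j′) →-dec (outer? j′ ×-dec (ρ j′ ≤? 4 + ρ j + 2)))

ρ-distinct-mod-4 : ∀ (t : Fin 2) j j′ → ρ j ≡ 4 * toℕ t + ρ j′ → toℕ t ≡ 0 × j ≡ j′
ρ-distinct-mod-4 = from-yes (all? λ (t : Fin 2) → all? λ (j : Offset) → all? λ (j′ : Offset) →
  (ρ j ≟ 4 * toℕ t + ρ j′) →-dec ((toℕ t ≟ 0) ×-dec (j Fin.≟ j′)))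

ρ≤6 : ∀ j → ρ j ≤ 6
ρ≤6 zero                   = ≤-refl
ρ≤6 (suc zero)             = s≤s (s≤s (s≤s z≤n))
ρ≤6 (suc (suc zero))       = s≤s z≤n
ρ≤6 (suc (suc (suc zero))) = z≤n

private
  rise : ∀ x t r → 4 * (x + t) + r ≡ 4 * x + (4 * t + r)
  rise = solve-∀

  fall : ∀ x d r → 4 * suc (x + d) + r ≡ 4 * x + (4 * suc d + r)
  fall = solve-∀

  plus-two : ∀ x r → 4 * x + (r + 2) ≡ 4 * x + r + 2
  plus-two = solve-∀

  fall-two : ∀ x r → 4 * x + (4 + r + 2) ≡ 4 * suc (x + 0) + r + 2
  fall-two = solve-∀

  fall-gap : ∀ x d {j j′} → weight (suc (x + d)) j < weight x j′ → 4 * suc d + ρ j < ρ j′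
  fall-gap x d {j} {j′} w< = +-cancelˡ-< (4 * x) _ _ (subst (_< weight x j′) (fall x d (ρ j)) w<)

  4t+n≤6⇒t<2 : ∀ {t n} → 4 * t + n ≤ 6 → t < 2
  4t+n≤6⇒t<2 {t} le with t <? 2
  ... | yes t<2 = t<2
  ... | no t≮2  = ⊥-elim (≤⇒≯ (≤-trans (*-monoʳ-≤ 4 (≮⇒≥ t≮2)) (≤-trans (m≤m+n _ _) le)) (n≤1+n 7))

weight-injective-≤ : ∀ {x j x′ j′} → x ≤ x′ → weight x j ≡ weight x′ j′ → x ≡ x′ × j ≡ j′
weight-injective-≤ {x} {j} {_} {j′} x≤x′ eq with m≤n⇒∃[o]m+o≡n x≤x′
... | t , refl = conclude (for-all-below {Q = Q} ρ-distinct-mod-4 t t<2 j j′ ρj≡)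
  where
  Q : ℕ → Set
  Q t = ∀ j j′ → ρ j ≡ 4 * t + ρ j′ → t ≡ 0 × j ≡ j′
  ρj≡ : ρ j ≡ 4 * t + ρ j′
  ρj≡ = +-cancelˡ-≡ (4 * x) _ _ (trans eq (rise x t (ρ j′)))
  t<2 : t < 2
  t<2 = 4t+n≤6⇒t<2 (≤-trans (≤-reflexive (sym ρj≡)) (ρ≤6 j))
  conclude : t ≡ 0 × j ≡ j′ → x ≡ x + t × j ≡ j′
  conclude (refl , j≡j′) = sym (+-identityʳ x) , j≡j′

weight-injective : ∀ {x j x′ j′} → weight x j ≡ weight x′ j′ → x ≡ x′ × j ≡ j′
weight-injective {x} {_} {x′} eq with ≤-total x x′
... | inj₁ x≤x′ = weight-injective-≤ x≤x′ eq
... | inj₂ x′≤x with weight-injective-≤ x′≤x (sym eq)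
...   | x′≡x , j′≡j = sym x′≡x , sym j′≡j

weight-near-rise : ∀ x t {j j′} → weight x j < weight (x + t) j′ → ¬ toℕ j′ ≤ t + toℕ j →
  Outer j′ × weight (x + t) j′ ≤ weight x j + 2
weight-near-rise x t {j} {j′} w< j′≰ = proj₁ jump , (begin
  weight (x + t) j′        ≡⟨ rise x t (ρ j′) ⟩
  4 * x + (4 * t + ρ j′)   ≤⟨ +-monoʳ-≤ (4 * x) (proj₂ jump) ⟩
  4 * x + (ρ j + 2)        ≡⟨ plus-two x (ρ j) ⟩
  weight x j + 2           ∎)
  where
  open ≤-Reasoning
  Q : ℕ → Set
  Q t = ∀ j j′ → t + toℕ j < toℕ j′ → ρ j < 4 * t + ρ j′ → Outer j′ × 4 * t + ρ j′ ≤ ρ j + 2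
  t<3 : t < 3
  t<3 = <-≤-trans (≤-<-trans (m≤m+n t (toℕ j)) (≰⇒> j′≰)) (≤-pred (toℕ<n j′))
  ρ< : ρ j < 4 * t + ρ j′
  ρ< = +-cancelˡ-< (4 * x) _ _ (subst (weight x j <_) (rise x t (ρ j′)) w<)
  jump : Outer j′ × 4 * t + ρ j′ ≤ ρ j + 2
  jump = for-all-below {Q = Q} weight-jump t t<3 j j′ (≰⇒> j′≰) ρ<

weight-near-fall : ∀ x d {j j′} → weight (suc (x + d)) j < weight x j′ →
  Outer j′ × weight x j′ ≤ weight (suc (x + d)) j + 2
weight-near-fall x zero {j} {j′} w< = proj₁ (weight-drop j j′ gap) , (begin
  4 * x + ρ j′               ≤⟨ +-monoʳ-≤ (4 * x) (proj₂ (weight-drop j j′ gap)) ⟩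
  4 * x + (4 + ρ j + 2)      ≡⟨ fall-two x (ρ j) ⟩
  weight (suc (x + 0)) j + 2 ∎)
  where
  open ≤-Reasoning
  gap = fall-gap x 0 w<
weight-near-fall x (suc d) {j} {j′} w<
  with 4t+n≤6⇒t<2 {suc (suc d)} (<⇒≤ (<-≤-trans (fall-gap x (suc d) w<) (ρ≤6 j′)))
... | s≤s (s≤s ())

weight-near : ∀ {x j x′ j′} → weight x j < weight x′ j′ →
  (x ≤ x′ × x + toℕ j′ ≤ x′ + toℕ j) ⊎ (Outer j′ × weight x′ j′ ≤ weight x j + 2)
weight-near {x} {j} {x′} {j′} w< with x ≤? x′
... | no x≰x′ with m≤n⇒∃[o]m+o≡n (≰⇒> x≰x′)
...   | d , refl = inj₂ (weight-near-fall x′ d w<)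
weight-near {x} {j} {x′} {j′} w< | yes x≤x′ with m≤n⇒∃[o]m+o≡n x≤x′
...   | t , refl with toℕ j′ ≤? t + toℕ j
...     | yes j′≤ = inj₁ (x≤x′ , subst (x + toℕ j′ ≤_) (sym (+-assoc x t (toℕ j))) (+-monoʳ-≤ x j′≤))
...     | no j′≰  = inj₂ (weight-near-rise x t w< j′≰)

outer-weight-even : ∀ {x j} → Outer j → ∃ λ m → weight x j ≡ 2 * m
outer-weight-even {x} (inj₁ refl) = 2 * x + 3 , double x 3
  where double : ∀ x e → 4 * x + 2 * e ≡ 2 * (2 * x + e)
        double = solve-∀
outer-weight-even {x} (inj₂ refl) = 2 * x , double x
  where double : ∀ x → 4 * x + 0 ≡ 2 * (2 * x)
        double = solve-∀

even-gap : ∀ {m n} → 2 * m < 2 * n → 2 * m + 2 ≤ 2 * n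
even-gap {m} {n} lt = subst (_≤ 2 * n) (double m) (*-monoʳ-≤ 2 (*-cancelˡ-< 2 m n lt))
  where double : ∀ m → 2 * suc m ≡ 2 * m + 2
        double = solve-∀

outer-separated : ∀ {x j x′ j′} → Outer j → Outer j′ → weight x j < weight x′ j′ →
  weight x j + 2 ≤ weight x′ j′
outer-separated {x} {j} {x′} {j′} o o′ w< with outer-weight-even {x} o | outer-weight-even {x′} o′
... | m , w≡ | m′ , w′≡ =
  subst₂ (λ a b → a + 2 ≤ b) (sym w≡) (sym w′≡) (even-gap {m} {m′} (subst₂ _<_ w≡ w′≡ w<))

private
  cross-offsets : ∀ x x′ j j′ y y′ c k → x + k ≡ c + j + y → x′ + k ≡ c + j′ + y′ →
    x + j′ + y′ ≡ x′ + j + y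
  cross-offsets x x′ j j′ y y′ c k e e′ = +-cancelʳ-≡ k _ _ (begin
    x + j′ + y′ + k       ≡⟨ swap x j′ y′ k ⟩
    x + k + (j′ + y′)     ≡⟨ cong (_+ (j′ + y′)) e ⟩
    c + j + y + (j′ + y′) ≡⟨ exchange c j y j′ y′ ⟩
    c + j′ + y′ + (j + y) ≡⟨ cong (_+ (j + y)) e′ ⟨
    x′ + k + (j + y)      ≡⟨ swap x′ j y k ⟨
    x′ + j + y + k        ∎)
    where
    open ≡-Reasoning
    swap : ∀ x j y k → x + j + y + k ≡ x + k + (j + y)
    swap = solve-∀
    exchange : ∀ c j y j′ y′ → c + j + y + (j′ + y′) ≡ c + j′ + y′ + (j + y)
    exchange = solve-∀

  ≤-compensate : ∀ {a b c d} → a + c ≡ b + d → a ≤ b → d ≤ c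
  ≤-compensate {a} {b} {c} {d} eq a≤b = +-cancelˡ-≤ a d c (≤-trans (+-monoˡ-≤ d a≤b) (≤-reflexive (sym eq)))

module Bands (k : ℕ) where

  X Y : Grid k → ℕ
  X = toℕ ∘ proj₁
  Y = toℕ ∘ proj₂

  -- diagonal u indexes the diagonal X − Y = const through u; a band is four consecutive ones.
  diagonal : Grid k → ℕ
  diagonal u = X u + (k ∸ Y u)

  band : Grid k → ℕ
  band u = diagonal u / 4

  offset : Grid k → Offset
  offset u = diagonal u mod 4

  key : Grid k → ℕ
  key u = weight (X u) (offset u)

  OuterPoint : Grid k → Set
  OuterPoint u = Outer (offset u)

  band-equation : ∀ u → X u + k ≡ 4 * band u + toℕ (offset u) + Y u
  band-equation u = begin
    X u + k                               ≡⟨ cong (X u +_) (m∸n+n≡m (<⇒≤ (toℕ<n (proj₂ u)))) ⟨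
    X u + (k ∸ Y u + Y u)                 ≡⟨ +-assoc (X u) _ _ ⟨
    diagonal u + Y u                      ≡⟨ cong (_+ Y u) (m≡m%n+[m/n]*n (diagonal u) 4) ⟩
    diagonal u % 4 + band u * 4 + Y u     ≡⟨ cong (λ r → r + band u * 4 + Y u) (toℕ-fromℕ< (m%n<n (diagonal u) 4)) ⟨
    toℕ (offset u) + band u * 4 + Y u     ≡⟨ cong (_+ Y u) (+-comm (toℕ (offset u)) (band u * 4)) ⟩
    band u * 4 + toℕ (offset u) + Y u     ≡⟨ cong (λ c → c + toℕ (offset u) + Y u) (*-comm (band u) 4) ⟩
    4 * band u + toℕ (offset u) + Y u     ∎
    where open ≡-Reasoning

  band<⌈k/2⌉ : ∀ u → band u < ⌈ k /2⌉
  band<⌈k/2⌉ u = *-cancelʳ-< 4 _ _ (begin-strict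
    band u * 4                   ≤⟨ m≤n+m _ (diagonal u % 4) ⟩
    diagonal u % 4 + band u * 4  ≡⟨ m≡m%n+[m/n]*n (diagonal u) 4 ⟨
    X u + (k ∸ Y u)              <⟨ +-mono-<-≤ (toℕ<n (proj₁ u)) (m∸n≤m k (Y u)) ⟩
    k + k                        ≤⟨ +-mono-≤ k≤ k≤ ⟩
    2 * ⌈ k /2⌉ + 2 * ⌈ k /2⌉   ≡⟨ quadruple ⌈ k /2⌉ ⟩
    ⌈ k /2⌉ * 4                  ∎)
    where
    open ≤-Reasoning
    k≤ : k ≤ 2 * ⌈ k /2⌉
    k≤ = ≤-pred (n≤1+2*⌊n/2⌋ (suc k))
    quadruple : ∀ n → 2 * n + 2 * n ≡ n * 4
    quadruple = solve-∀

  module _ {u v} (same : band u ≡ band v) where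

    private
      crossed : X u + toℕ (offset v) + Y v ≡ X v + toℕ (offset u) + Y u
      crossed = cross-offsets (X u) (X v) _ _ (Y u) (Y v) (4 * band v) k
                  (subst (λ b → X u + k ≡ 4 * b + toℕ (offset u) + Y u) same (band-equation u))
                  (band-equation v)

    key-injective : key u ≡ key v → u ≡ v
    key-injective eq with weight-injective {X u} {offset u} {X v} {offset v} eq
    ... | X≡ , offset≡ = cong₂ _,_ (toℕ-injective X≡) (toℕ-injective (sym Y≡))
      where
      Y≡ : Y v ≡ Y u
      Y≡ = +-cancelˡ-≡ (X u + toℕ (offset v)) _ _
             (trans crossed (cong₂ (λ x j → x + toℕ j + Y u) (sym X≡) offset≡))

    key-near : key u < key v → u ≤G v ⊎ OuterPoint v × key v ≤ key u + 2
    key-near lt with weight-near {X u} {offset u} {X v} {offset v} lt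
    ... | inj₁ (X≤ , shifted≤) = inj₁ (X≤ , ≤-compensate crossed shifted≤)
    ... | inj₂ outer = inj₂ outer

  _≤G?_ : Decidable (_≤G_ {k})
  u ≤G? v = (X u ≤? X v) ×-dec (Y u ≤? Y v)

  ≤G-refl : ∀ {u : Grid k} → u ≤G u
  ≤G-refl = ≤-refl , ≤-refl

  open NearChain _≤G_ _≤G?_ key OuterPoint public

  private
    module KeyOrder = DecTotalOrder (On.decTotalOrder ≤-decTotalOrder key)
    open import Data.List.Sort (On.decTotalOrder ≤-decTotalOrder key) using (sort; sort-↭; sort-↗)
    open import Data.List.Relation.Binary.Permutation.Setoid.Properties (setoid (Grid k)) using (Unique-resp-↭)

  near-in-band : ∀ {u v} → band u ≡ band v → key u ≤ key v → u ≢ v → Near u v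
  near-in-band {u} {v} same key≤ u≢v =
    key< , key-near same key< , λ o o′ → outer-separated {X u} {offset u} {X v} {offset v} o o′ key<
    where
    key< = ≤∧≢⇒< key≤ (u≢v ∘ key-injective same)

  sorted-band-near : ∀ b (S : List (Grid k)) → Unique S → All (λ u → band u ≡ b) S → AllPairs Near (sort S)
  sorted-band-near b S unique inBand =
    AllPairs-within (λ {u} {v} u∈b v∈b (key≤ , u≢v) → near-in-band (trans u∈b (sym v∈b)) key≤ u≢v)
      (All-resp-↭ (↭-sym (sort-↭ S)) inBand)
      (AllPairs.zip (Sorted⇒AllPairs KeyOrder.totalOrder (sort-↗ S) ,
                     Unique-resp-↭ (↭⇒↭ₛ (↭-sym (sort-↭ S))) unique))

  band-embedding : ∀ {n} {R : Rel (Fin n) 0ℓ} {h} → RankFunction R h → Grid k →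
    ∀ b (S : List (Grid k)) (unique : Unique S) → All (λ u → band u ≡ b) S → n + h ≤ length S + 1 →
    WeakSub R (S , unique)
  band-embedding {n} {R} {h} (ℓ , ℓ<h , ℓ-mono) u₀ b S unique inBand budget
    with Embedding.embed Fin._≟_ u₀ h ℓ (allFin n) (λ {p} _ → ℓ<h p) (sort S)
           (sorted-band-near b S unique inBand)
           (subst₂ (λ m l → m + h ≤ l + 1) (sym (length-tabulate id)) (sym (↭-length (sort-↭ S))) budget)
  ... | f , f-∈ , f-injective , f-mono =
    f , injective , (λ p → ∈-resp-↭ (sort-↭ S) (f-∈ (∈-allFin p))) , monotone
    where
    injective : ∀ {p q} → f p ≡ f q → p ≡ q
    injective = f-injective (∈-allFin _) (∈-allFin _)
    monotone : ∀ p q → R p q → f p ≤G f q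
    monotone p q Rpq with ℓ-mono p q Rpq
    ... | inj₁ refl = ≤G-refl
    ... | inj₂ ℓp<ℓq = f-mono (∈-allFin p) (∈-allFin q) ℓp<ℓq

upper-bound : ∀ {n} {R : Rel (Fin n) 0ℓ} {h} → RankFunction R h →
  ∀ k (F : Subset² k) → WeakFree R F → 2 * ∣ F ∣S + 2 * k ≤ (n + h) * k + (n + h)
upper-bound rank zero ([] , _) free = z≤n
upper-bound rank zero (((() , _) ∷ _) , _) free
upper-bound {n} {R} {h} rank k@(suc _) (xs , unique) free = begin
  2 * length xs + 2 * k                     ≤⟨ +-monoʳ-≤ (2 * length xs) (*-monoʳ-≤ 2 k≤2B) ⟩
  2 * length xs + 2 * (2 * B)               ≡⟨ *-distribˡ-+ 2 (length xs) (2 * B) ⟨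
  2 * (length xs + 2 * B)                   ≤⟨ *-monoʳ-≤ 2 (length-by-classes band B xs bands<B band-bounded) ⟩
  2 * (B * (n + h))                         ≡⟨ *-assoc 2 B (n + h) ⟨
  2 * B * (n + h)                           ≤⟨ *-monoˡ-≤ (n + h) (2*⌊n/2⌋≤n (suc k)) ⟩
  suc k * (n + h)                           ≡⟨ +-comm (n + h) _ ⟩
  k * (n + h) + (n + h)                     ≡⟨ cong (_+ (n + h)) (*-comm k (n + h)) ⟩
  (n + h) * k + (n + h)                     ∎
  where
  open ≤-Reasoning
  open Bands k
  B = ⌈ k /2⌉
  bands<B : All (λ u → band u < B) xs
  bands<B = All.tabulate λ {u} _ → band<⌈k/2⌉ u
  k≤2B : k ≤ 2 * B
  k≤2B = ≤-pred (n≤1+2*⌊n/2⌋ (suc k))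
  in-band : ℕ → List (Grid k)
  in-band b = filter (λ u → band u ≟ b) xs
  in-band⁻ : ∀ {b u} → u ∈ in-band b → u ∈ xs × band u ≡ b
  in-band⁻ {b} = ∈-filter⁻ (λ u → band u ≟ b) {xs = xs}
  band-bounded : ∀ b → length (in-band b) + 2 ≤ n + h
  band-bounded b with n + h ≤? length (in-band b) + 1
  ... | no  too-few = subst (_≤ n + h) (sym (+-suc _ 1)) (≰⇒> too-few)
  ... | yes enough with band-embedding rank (zero , zero) b _ (Unique.filter⁺ _ unique)
                          (All.tabulate (proj₂ ∘ in-band⁻)) enough
  ...   | i , injective , i∈ , monotone = ⊥-elim (free (i , injective , proj₁ ∘ in-band⁻ ∘ i∈ , monotone))

¬¬-Π-Fin : ∀ {n} {Q : Fin n → Set} → (∀ i → ¬ ¬ Q i) → ¬ ¬ (∀ i → Q i)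
¬¬-Π-Fin {zero}  _    ¬Π = ¬Π λ ()
¬¬-Π-Fin {suc n} ¬¬Q ¬Π =
  ¬¬Q zero λ Q₀ → ¬¬-Π-Fin (¬¬Q ∘ suc) λ Qₛ → ¬Π λ { zero → Q₀ ; (suc i) → Qₛ i }

¬¬-decidable : ∀ {n} (R : Rel (Fin n) 0ℓ) → ¬ ¬ Decidable R
¬¬-decidable R = ¬¬-Π-Fin λ _ → ¬¬-Π-Fin λ _ → ¬¬-excluded-middle

-- The order of P need not be decidable, but the conclusion is, so we may assume it is.
poset-upper-bound : (P : FinPoset) (h : ℕ) → IsHeight P h → ∀ k (F : Subset² k) →
  WeakFree (FinPoset._≤P_ P) F → 2 * ∣ F ∣S + 2 * k ≤ (∣ P ∣P + h) * k + (∣ P ∣P + h)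
poset-upper-bound P h (_ , chains≤h) k F free =
  decidable-stable (_ ≤? _) λ ¬bound → ¬¬-decidable (FinPoset._≤P_ P) λ _≤?_ →
    ¬bound (upper-bound (Mirsky.ranking P _≤?_ h chains≤h) k F free)

module DiamondLevel (m : ℕ) where

  level : Fin (suc (suc m)) → ℕ
  level zero = 0
  level (suc x) with toℕ x ≟ m
  ... | yes _ = 2
  ... | no _  = 1

  0<level-suc : ∀ x → 0 < level (suc x)
  0<level-suc x with toℕ x ≟ m
  ... | yes _ = s≤s z≤n
  ... | no _  = s≤s z≤n

  level<3 : ∀ x → level x < 3
  level<3 zero = s≤s z≤n
  level<3 (suc x) with toℕ x ≟ m
  ... | yes _ = s≤s (s≤s (s≤s z≤n))
  ... | no _  = s≤s (s≤s z≤n)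

  level-top : ∀ x → toℕ x ≡ m → level (suc x) ≡ 2
  level-top x top with toℕ x ≟ m
  ... | yes _ = refl
  ... | no ¬top = ⊥-elim (¬top top)

  monotone : ∀ x y → Diamond m x y → x ≡ y ⊎ level x < level y
  monotone x y (inj₁ x≡y) = inj₁ x≡y
  monotone zero zero (inj₂ _) = inj₁ refl
  monotone zero (suc y) (inj₂ _) = inj₂ (0<level-suc y)
  monotone (suc x) zero (inj₂ (inj₂ ()))
  monotone (suc x) (suc y) (inj₂ (inj₂ top)) with toℕ x ≟ m
  ... | yes x-top = inj₁ (cong suc (toℕ-injective (trans x-top (sym (suc-injective top)))))
  ... | no _ = inj₂ (subst (1 <_) (sym (level-top y (suc-injective top))) ≤-refl)

  ranked : RankFunction (Diamond m) 3
  ranked = level , level<3 , monotone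

diamond-upper-bound : ∀ m k (F : Subset² k) → WeakFree (Diamond m) F →
  2 * ∣ F ∣S + 2 * k ≤ (2 + m + 3) * k + (2 + m + 3)
diamond-upper-bound m = upper-bound (DiamondLevel.ranked m)

-- Diamond-free families on three antidiagonals

Adjacent : ℕ → ℕ → Set
Adjacent z x = x ≡ z ⊎ x ≡ suc z

pigeonhole : ∀ {z x₁ x₂ x₃} → Adjacent z x₁ → Adjacent z x₂ → Adjacent z x₃ →
  x₁ ≡ x₂ ⊎ x₁ ≡ x₃ ⊎ x₂ ≡ x₃
pigeonhole (inj₁ refl) (inj₁ refl) _           = inj₁ refl
pigeonhole (inj₂ refl) (inj₂ refl) _           = inj₁ refl
pigeonhole (inj₁ refl) (inj₂ refl) (inj₁ refl) = inj₂ (inj₁ refl)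
pigeonhole (inj₁ refl) (inj₂ refl) (inj₂ refl) = inj₂ (inj₂ refl)
pigeonhole (inj₂ refl) (inj₁ refl) (inj₁ refl) = inj₂ (inj₂ refl)
pigeonhole (inj₂ refl) (inj₁ refl) (inj₂ refl) = inj₂ (inj₁ refl)

Odd : ℕ → Set
Odd x = ∃ λ t → x ≡ suc (2 * t)

adjacent-odd : ∀ {z x x′} → Adjacent z x → Adjacent z x′ → Odd x → Odd x′ → x ≡ x′
adjacent-odd (inj₁ refl) (inj₁ refl) _ _ = refl
adjacent-odd (inj₂ refl) (inj₂ refl) _ _ = refl
adjacent-odd (inj₁ refl) (inj₂ refl) (t , refl) (t′ , eq) = ⊥-elim (even≢odd t′ t (suc-injective (sym eq)))
adjacent-odd (inj₂ refl) (inj₁ refl) (t , eq) (t′ , refl) = ⊥-elim (even≢odd t t′ (suc-injective (sym eq)))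

module Antidiagonals (k : ℕ) where

  X Y level : Grid k → ℕ
  X = toℕ ∘ proj₁
  Y = toℕ ∘ proj₂
  level u = X u + Y u

  level-< : ∀ {u v} → u ≤G v → u ≢ v → level u < level v
  level-< {u} {v} (X≤ , Y≤) u≢v with m≤n⇒m<n∨m≡n X≤ | m≤n⇒m<n∨m≡n Y≤
  ... | inj₁ X< | _      = +-mono-<-≤ X< Y≤
  ... | inj₂ X≡ | inj₁ Y< = +-mono-≤-< X≤ Y<
  ... | inj₂ X≡ | inj₂ Y≡ = ⊥-elim (u≢v (cong₂ _,_ (toℕ-injective X≡) (toℕ-injective Y≡)))

  step-X : ∀ {u v} → u ≤G v → suc (level u) ≡ level v → X v ≡ X u ⊎ X v ≡ suc (X u)
  step-X {u} {v} (X≤ , Y≤) up with m≤n⇒m<n∨m≡n X≤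
  ... | inj₂ X≡ = inj₁ (sym X≡)
  ... | inj₁ X< = inj₂ (≤-antisym (+-cancelʳ-≤ (Y u) _ _ (≤-trans (+-monoʳ-≤ (X v) Y≤) (≤-reflexive (sym up)))) X<)

  level-X-injective : ∀ {u v} → level u ≡ level v → X u ≡ X v → u ≡ v
  level-X-injective {u} {v} level≡ X≡ =
    cong₂ _,_ (toℕ-injective X≡) (toℕ-injective (+-cancelˡ-≡ (X u) _ _ (trans level≡ (cong (_+ Y v) (sym X≡)))))

  module Segment (r : ℕ) {m} (x : Fin m → ℕ) (x-injective : ∀ {i j} → x i ≡ x j → i ≡ j)
                 (x≤r : ∀ j → x j ≤ r) (x<k : ∀ j → x j < k) (r∸x<k : ∀ j → r ∸ x j < k) where

    point : Fin m → Grid k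
    point j = fromℕ< (x<k j) , fromℕ< (r∸x<k j)

    points : List (Grid k)
    points = tabulate point

    length-points : length points ≡ m
    length-points = length-tabulate point

    X-point : ∀ j → X (point j) ≡ x j
    X-point j = toℕ-fromℕ< (x<k j)

    level-point : ∀ j → level (point j) ≡ r
    level-point j = trans (cong₂ _+_ (X-point j) (toℕ-fromℕ< (r∸x<k j))) (m+[n∸m]≡n (x≤r j))

    unique : Unique points
    unique = Unique.tabulate⁺ λ eq → x-injective (trans (sym (X-point _)) (trans (cong X eq) (X-point _)))

    ∈-points : ∀ {u} → u ∈ points → level u ≡ r × ∃ λ j → X u ≡ x j
    ∈-points u∈ with ∈-tabulate⁻ u∈
    ... | j , refl = level-point j , j , X-point j

  Between : ℕ → Grid k → Set
  Between r u = r ≤ level u × level u ≤ suc (suc r)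

  middle-of-three : ∀ {r a b c} → Between r a → Between r c → a ≤G b → b ≤G c → a ≢ b → b ≢ c →
    level b ≡ suc r × Adjacent (X a) (X b)
  middle-of-three {r} {a} {b} {c} (r≤a , _) (_ , c≤) a≤b b≤c a≢b b≢c =
    b≡ , step-X a≤b (trans (cong suc a≡) (sym b≡))
    where
    a<b = level-< a≤b a≢b
    b<c = level-< b≤c b≢c
    b≡ : level b ≡ suc r
    b≡ = ≤-antisym (≤-pred (≤-trans b<c c≤)) (≤-trans (s≤s r≤a) a<b)
    a≡ : level a ≡ r
    a≡ = ≤-antisym (≤-pred (subst (level a <_) b≡ a<b)) r≤a

  module DiamondIn {m r} {xs : List (Grid k)} (between : All (Between r) xs)
                   (i : Fin (suc (suc m)) → Grid k) (i-injective : ∀ {p q} → i p ≡ i q → p ≡ q)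
                   (i∈ : ∀ p → i p ∈ xs) (i-mono : ∀ p q → Diamond m p q → i p ≤G i q) where

    Middle : Fin (suc (suc m)) → Set
    Middle j = level (i j) ≡ suc r × Adjacent (X (i zero)) (X (i j))

    middle : ∀ j → zero ≢ j → j ≢ Fin.fromℕ (suc m) → Middle j
    middle j bottom≢j j≢top =
      middle-of-three (All.lookup between (i∈ zero)) (All.lookup between (i∈ (Fin.fromℕ (suc m))))
        (i-mono zero j (inj₂ (inj₁ refl))) (i-mono j (Fin.fromℕ (suc m)) (inj₂ (inj₂ (toℕ-fromℕ (suc m)))))
        (bottom≢j ∘ i-injective) (j≢top ∘ i-injective)

    distinct-X : ∀ {j j′} → j ≢ j′ → level (i j) ≡ suc r → level (i j′) ≡ suc r → X (i j) ≢ X (i j′)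
    distinct-X j≢j′ level≡ level′≡ X≡ =
      j≢j′ (i-injective (level-X-injective (trans level≡ (sym level′≡)) X≡))

    no-three-middles : ∀ {j₁ j₂ j₃} → j₁ ≢ j₂ → j₁ ≢ j₃ → j₂ ≢ j₃ → Middle j₁ → Middle j₂ → Middle j₃ → ⊥
    no-three-middles j₁≢j₂ j₁≢j₃ j₂≢j₃ (l₁ , a₁) (l₂ , a₂) (l₃ , a₃) with pigeonhole a₁ a₂ a₃
    ... | inj₁ X≡           = distinct-X j₁≢j₂ l₁ l₂ X≡
    ... | inj₂ (inj₁ X≡)    = distinct-X j₁≢j₃ l₁ l₃ X≡
    ... | inj₂ (inj₂ X≡)    = distinct-X j₂≢j₃ l₂ l₃ X≡

  module Stack {r} (L₀ L₁ L₂ : List (Grid k)) (u₀ : Unique L₀) (u₁ : Unique L₁) (u₂ : Unique L₂)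
               (l₀ : ∀ {u} → u ∈ L₀ → level u ≡ r) (l₁ : ∀ {u} → u ∈ L₁ → level u ≡ suc r)
               (l₂ : ∀ {u} → u ∈ L₂ → level u ≡ suc (suc r)) where

    private
      separate : ∀ {xs ys : List (Grid k)} {s t} → s ≢ t →
        (∀ {u} → u ∈ xs → level u ≡ s) → (∀ {u} → u ∈ ys → level u ≡ t) → Disjoint xs ys
      separate s≢t ls lt (u∈xs , u∈ys) = s≢t (trans (sym (ls u∈xs)) (lt u∈ys))

    family : Subset² k
    family = L₀ ++ L₁ ++ L₂ ,
      Unique.++⁺ u₀ (Unique.++⁺ u₁ u₂ (separate (<⇒≢ (n<1+n _)) l₁ l₂))
        λ (u∈L₀ , u∈) → [ (λ u∈L₁ → separate (<⇒≢ (n<1+n r)) l₀ l₁ (u∈L₀ , u∈L₁))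
                        , (λ u∈L₂ → separate (<⇒≢ (m<n⇒m<1+n (n<1+n r))) l₀ l₂ (u∈L₀ , u∈L₂)) ]′ (∈-++⁻ L₁ u∈)

    size : ∣ family ∣S ≡ length L₀ + (length L₁ + length L₂)
    size = trans (length-++ L₀) (cong (length L₀ +_) (length-++ L₁))

    between : All (Between r) (proj₁ family)
    between = All.tabulate λ u∈ → bounds (∈-++⁻ L₀ u∈)
      where
      bounds : ∀ {u} → u ∈ L₀ ⊎ u ∈ L₁ ++ L₂ → Between r u
      bounds (inj₁ u∈) = ≤-reflexive (sym (l₀ u∈)) , ≤-trans (≤-reflexive (l₀ u∈)) (≤-trans (n≤1+n r) (n≤1+n _))
      bounds (inj₂ u∈) with ∈-++⁻ L₁ u∈
      ... | inj₁ u∈L₁ = let eq = l₁ u∈L₁ in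
                        ≤-trans (n≤1+n r) (≤-reflexive (sym eq)) , ≤-trans (≤-reflexive eq) (n≤1+n _)
      ... | inj₂ u∈L₂ = let eq = l₂ u∈L₂ in
                        ≤-trans (≤-trans (n≤1+n r) (n≤1+n _)) (≤-reflexive (sym eq)) , ≤-reflexive eq

    ∈-middle : ∀ {u} → u ∈ proj₁ family → level u ≡ suc r → u ∈ L₁
    ∈-middle u∈ mid with ∈-++⁻ L₀ u∈
    ... | inj₁ u∈L₀ = ⊥-elim (1+n≢n (trans (sym mid) (l₀ u∈L₀)))
    ... | inj₂ u∈ with ∈-++⁻ L₁ u∈
    ...   | inj₁ u∈L₁ = u∈L₁
    ...   | inj₂ u∈L₂ = ⊥-elim (1+n≢n (trans (sym (l₂ u∈L₂)) mid))

module Families (m : ℕ) where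

  k : ℕ
  k = suc (suc m)

  open Antidiagonals k

  private
    residual<k : ∀ x → suc m ∸ x < k
    residual<k x = s≤s (m∸n≤m (suc m) x)

    2j+1<k : ∀ (j : Fin ⌊ k /2⌋) → suc (2 * toℕ j) < k
    2j+1<k j = ≤-trans (≤-reflexive (sym (*-suc 2 (toℕ j)))) (≤-trans (*-monoʳ-≤ 2 (toℕ<n j)) (2*⌊n/2⌋≤n k))

  module Low = Segment (suc m) {k} toℕ toℕ-injective (λ j → ≤-pred (toℕ<n j)) toℕ<n (residual<k ∘ toℕ)

  module Mid = Segment (suc (suc m)) {suc m} (λ j → 1 + toℕ j) (toℕ-injective ∘ suc-injective)
                 (λ j → s≤s (m≤n⇒m≤1+n (≤-pred (toℕ<n j)))) (s≤s ∘ toℕ<n) (residual<k ∘ toℕ)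

  module High = Segment (suc (suc (suc m))) {m} (λ j → 2 + toℕ j) (toℕ-injective ∘ suc-injective ∘ suc-injective)
                  (λ j → s≤s (s≤s (m≤n⇒m≤1+n (<⇒≤ (toℕ<n j))))) (s≤s ∘ s≤s ∘ toℕ<n) (residual<k ∘ toℕ)

  module OddMid = Segment (suc (suc m)) {⌊ k /2⌋} (λ j → suc (2 * toℕ j))
                    (λ eq → toℕ-injective (*-cancelˡ-≡ _ _ 2 (suc-injective eq))) (<⇒≤ ∘ 2j+1<k) 2j+1<k
                    (residual<k ∘ (2 *_) ∘ toℕ)

  module Full = Stack Low.points Mid.points High.points Low.unique Mid.unique High.unique
                  (proj₁ ∘ Low.∈-points) (proj₁ ∘ Mid.∈-points) (proj₁ ∘ High.∈-points)

  module Sparse = Stack Low.points OddMid.points High.points Low.unique OddMid.unique High.unique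
                    (proj₁ ∘ Low.∈-points) (proj₁ ∘ OddMid.∈-points) (proj₁ ∘ High.∈-points)

  full-D₃-free : WeakFree (Diamond 3) Full.family
  full-D₃-free (i , i-injective , i∈ , i-mono) =
    no-three-middles {suc zero} {suc (suc zero)} {suc (suc (suc zero))} (λ ()) (λ ()) (λ ())
      (middle _ (λ ()) (λ ())) (middle _ (λ ()) (λ ())) (middle _ (λ ()) (λ ()))
    where open DiamondIn Full.between i i-injective i∈ i-mono

  sparse-D₂-free : WeakFree (Diamond 2) Sparse.family
  sparse-D₂-free (i , i-injective , i∈ , i-mono) =
    let l₁ , a₁ = middle (suc zero) (λ ()) (λ ())
        l₂ , a₂ = middle (suc (suc zero)) (λ ()) (λ ())
    in distinct-X {suc zero} {suc (suc zero)} (λ ()) l₁ l₂ (adjacent-odd a₁ a₂ (odd l₁) (odd l₂))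
    where
    open DiamondIn Sparse.between i i-injective i∈ i-mono
    odd : ∀ {j} → level (i j) ≡ suc (suc m) → Odd (X (i j))
    odd {j} mid with OddMid.∈-points (Sparse.∈-middle (i∈ j) mid)
    ... | _ , t , X≡ = toℕ t , X≡

  full-size : 3 * k ≤ ∣ Full.family ∣S + 3
  full-size = ≤-reflexive (trans (count m) (cong (_+ 3) (sym full-length)))
    where
    full-length : ∣ Full.family ∣S ≡ k + (suc m + m)
    full-length = trans Full.size
      (cong₂ _+_ Low.length-points (cong₂ _+_ Mid.length-points High.length-points))
    count : ∀ m → 3 * suc (suc m) ≡ suc (suc m) + (suc m + m) + 3
    count = solve-∀

  sparse-size : 5 * k ≤ 2 * ∣ Sparse.family ∣S + 5
  sparse-size = begin
    5 * k                                    ≡⟨ count m ⟩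
    2 * k + k + 2 * m + 4                    ≤⟨ +-monoˡ-≤ 4 (+-monoˡ-≤ (2 * m) (+-monoʳ-≤ (2 * k) (n≤1+2*⌊n/2⌋ k))) ⟩
    2 * k + suc (2 * ⌊ k /2⌋) + 2 * m + 4   ≡⟨ regroup k ⌊ k /2⌋ m ⟩
    2 * (k + (⌊ k /2⌋ + m)) + 5              ≡⟨ cong (λ n → 2 * n + 5) sparse-length ⟨
    2 * ∣ Sparse.family ∣S + 5               ∎
    where
    open ≤-Reasoning
    sparse-length : ∣ Sparse.family ∣S ≡ k + (⌊ k /2⌋ + m)
    sparse-length = trans Sparse.size
      (cong₂ _+_ Low.length-points (cong₂ _+_ OddMid.length-points High.length-points))
    count : ∀ m → 5 * suc (suc m) ≡ 2 * suc (suc m) + suc (suc m) + 2 * m + 4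
    count = solve-∀
    regroup : ∀ k h m → 2 * k + suc (2 * h) + 2 * m + 4 ≡ 2 * (k + (h + m)) + 5
    regroup = solve-∀

from-2 : ∀ {Q : ℕ → Set} → (∀ m → Q (suc (suc m))) → ∀ k → 2 ≤ k → Q k
from-2 Q₂ (suc (suc m)) _ = Q₂ m
from-2 Q₂ (suc zero) (s≤s ())

D₂-bounds : ∀ m → let k = suc (suc m) in
  ((F : Subset² k) → WeakFree (Diamond 2) F → 2 * ∣ F ∣S ≤ 5 * k + 7)
  × (Σ (Subset² k) λ F → WeakFree (Diamond 2) F × 5 * k ≤ 2 * ∣ F ∣S + 7)
D₂-bounds m =
  upper , Sparse.family , sparse-D₂-free , ≤-trans sparse-size (+-monoʳ-≤ (2 * ∣ Sparse.family ∣S) (m≤m+n 5 2))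
  where
  open Families m
  upper : (F : Subset² k) → WeakFree (Diamond 2) F → 2 * ∣ F ∣S ≤ 5 * k + 7
  upper F free =
    +-cancelʳ-≤ (2 * k) _ _ (subst (2 * ∣ F ∣S + 2 * k ≤_) (split k) (diamond-upper-bound 2 k F free))
    where split : ∀ k → 7 * k + 7 ≡ 5 * k + 7 + 2 * k
          split = solve-∀

D₃-bounds : ∀ m → let k = suc (suc m) in
  ((F : Subset² k) → WeakFree (Diamond 3) F → ∣ F ∣S ≤ 3 * k + 4)
  × (Σ (Subset² k) λ F → WeakFree (Diamond 3) F × 3 * k ≤ ∣ F ∣S + 4)
D₃-bounds m =
  upper , Full.family , full-D₃-free , ≤-trans full-size (+-monoʳ-≤ ∣ Full.family ∣S (n≤1+n 3))
  where
  open Families m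
  upper : (F : Subset² k) → WeakFree (Diamond 3) F → ∣ F ∣S ≤ 3 * k + 4
  upper F free = *-cancelˡ-≤ 2 (subst (2 * ∣ F ∣S ≤_) (halve k)
                   (+-cancelʳ-≤ (2 * k) _ _ (subst (2 * ∣ F ∣S + 2 * k ≤_) (split k) (diamond-upper-bound 3 k F free))))
    where
    split : ∀ k → 8 * k + 8 ≡ 6 * k + 8 + 2 * k
    split = solve-∀
    halve : ∀ k → 6 * k + 8 ≡ 2 * (3 * k + 4)
    halve = solve-∀

proposition1p6 :
    ((P : FinPoset) → (h : ℕ) → IsHeight P h →
      ∃ λ K → ∃ λ C → ∀ k → K ≤ k → (F : Subset² k) → WeakFree (FinPoset._≤P_ P) F →
        2 * ∣ F ∣S + 2 * k ≤ (∣ P ∣P + h) * k + C)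
    × (∃ λ K → ∃ λ C → ∀ k → K ≤ k →
        ((F : Subset² k) → WeakFree (Diamond 2) F → 2 * ∣ F ∣S ≤ 5 * k + C)
        × (Σ (Subset² k) λ F → WeakFree (Diamond 2) F × 5 * k ≤ 2 * ∣ F ∣S + C))
    × (∃ λ K → ∃ λ C → ∀ k → K ≤ k →
        ((F : Subset² k) → WeakFree (Diamond 3) F → ∣ F ∣S ≤ 3 * k + C)
        × (Σ (Subset² k) λ F → WeakFree (Diamond 3) F × 3 * k ≤ ∣ F ∣S + C))
proposition1p6 =
  (λ P h height → 0 , ∣ P ∣P + h , λ k _ → poset-upper-bound P h height k) ,
  (2 , 7 , from-2 D₂-bounds) ,
  (2 , 4 , from-2 D₃-bounds)
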